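{- Let $D$ be a digraph with $n$ vertices and $m$ arcs (no multiple arcs) and let $f$ be an edge-magic labeling of $D$. Let $p,k$ be positive integers and let $h: E(D)\to \mathcal{S}_p^k$ be any function. Then there exists a function $\bar h: E(D)\to \mathcal{S}_p^{p+3-k}$ such that $D\otimes_h \mathcal{S}_p^k \cong D\otimes_{\bar h}\mathcal{S}_p^{p+3-k}$ and $\overline{\hat f}\simeq \hat{\overline f}$, where $\overline{\hat f}$ is the complementary labeling of the labeling $\hat f$ of $D\otimes_h\mathcal{S}_p^k$ induced by $f$, and $\hat{\overline f}$ is the labeling of $D\otimes_{\bar h}\mathcal{S}_p^{p+3-k}$ induced by the complementary labeling $\overline f$ of $f$.
   Context: Graphs and digraphs may have loops but no multiple edges/arcs. For integers $a\le b$, $[a,b]=\{a,a+1,\dots,b\}$. A $(p,q)$-(di)graph has $p$ vertices and $q$ edges. An edge-magic labeling of a $(p,q)$-(di)graph $G$ is a bijection $f:V(G)\cup E(G)\to[1,p+q]$ such that $f(x)+f(xy)+f(y)$ equals a constant $\mathrm{val}(f)$ (the valence) for every edge $xy$; it is super edge-magic if moreover $f(V(G))=[1,p]$. The complementary labeling of an edge-magic labeling $f$ is $\overline f(x)=p+q+1-f(x)$ for all $x\in V(G)\cup E(G)$; it is again edge-magic. $\mathcal{S}_p^k$ denotes the set of digraphs $F$ with vertex set $[1,p]$ and exactly $p$ arcs such that $\{i+j:(i,j)\in E(F)\}=[k,k+p-1]$ (i.e. super edge-magic digraphs of equal order and size whose vertices are named by their labels, with minimum induced arc sum $k$). For a digraph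 $D$ and a function $h$ from $E(D)$ to a family $\Gamma$ of digraphs all with the same vertex set $V$, the digraph $D\otimes_h\Gamma$ has vertex set $V(D)\times V$, and $((a,i),(b,j))$ is an arc iff $(a,b)\in E(D)$ and $(i,j)\in E(h(a,b))$. Given an edge-magic labeling $g$ of $D$ and $h:E(D)\to\mathcal{S}_p^k$, the labeling $\hat g$ of $D\otimes_h\mathcal{S}_p^k$ induced by $g$ is $\hat g(a,i)=p(g(a)-1)+i$ on vertices and $\hat g((a,i),(b,j))=p(g((a,b))-1)+k+p-(i+j)$ on arcs; it is an edge-magic labeling. For two labeled digraphs, $\simeq$ means there is a digraph isomorphism between them carrying one labeling to the other. -}

module Defs where

open import Data.Nat using (ℕ; zero; suc; _+_; _*_; _∸_; _≤_)
open import Data.Fin using (Fin; toℕ)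
open import Data.Bool using (Bool; true; false; T; _∧_)
open import Data.Bool.Properties using (T-∧)
open import Data.Product using (Σ; ∃; _×_; _,_; proj₁; proj₂)
open import Data.Sum using (_⊎_; inj₁; inj₂)
open import Function.Bundles using (_↔_; Inverse; Equivalence)
open import Relation.Binary.PropositionalEquality using (_≡_; subst)

-- A digraph (loops allowed, no multiple arcs) on a vertex type V is a
-- Boolean arc relation: there is an arc (x , y) iff  T (A x y).
Rel : Set → Set
Rel V = V → V → Bool

Arcs : {V : Set} → Rel V → Set
Arcs {V} A = Σ V λ x → Σ V λ y → T (A x y)

Labeling : {V : Set} → Rel V → Set
Labeling {V} A = V ⊎ Arcs A → ℕ

IsBijOnto : {V : Set} {A : Rel V} → ℕ → Labeling A → Set
IsBijOnto {V} {A} N f =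
  (∀ x → 1 ≤ f x × f x ≤ N)
  × (∀ x y → f x ≡ f y → x ≡ y)
  × (∀ l → 1 ≤ l → l ≤ N → ∃ λ x → f x ≡ l)

IsEdgeMagic : {V : Set} (A : Rel V) → ℕ → ℕ → Labeling A → Set
IsEdgeMagic {V} A p q f =
  IsBijOnto {V} {A} (p + q) f
  × ∃ λ val → ∀ x y (e : T (A x y)) →
      f (inj₁ x) + f (inj₂ (x , y , e)) + f (inj₁ y) ≡ val

complement : {V : Set} {A : Rel V} → ℕ → ℕ → Labeling A → Labeling A
complement p q f x = suc (p + q) ∸ f x

-- The vertex i : Fin p stands for the integer i + 1 ∈ [1 , p].
nm : {p : ℕ} → Fin p → ℕ
nm i = suc (toℕ i)

-- F ∈ S_p^k : F has vertex set [1 , p] (encoded as Fin p), exactly p arcs,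
-- and { i + j : (i , j) ∈ E(F) } = [k , k + p - 1].
InS : (p k : ℕ) → Rel (Fin p) → Set
InS p k F =
  (Arcs F ↔ Fin p)
  × (∀ i j → T (F i j) → k ≤ nm i + nm j × nm i + nm j ≤ k + p ∸ 1)
  × (∀ s → k ≤ s → s ≤ k + p ∸ 1 →
       ∃ λ (e : Arcs F) → nm (proj₁ e) + nm (proj₁ (proj₂ e)) ≡ s)

-- D ⊗_h Γ, where h is given on all pairs (only its values on arcs of D matter).
prodArc : {V : Set} {p : ℕ} → Rel V → (V → V → Rel (Fin p)) → Rel (V × Fin p)
prodArc A h (a , i) (b , j) = A a b ∧ h a b i j

induced : {V : Set} {A : Rel V} (p k : ℕ) (h : V → V → Rel (Fin p)) →
          Labeling A → Labeling (prodArc A h)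
induced p k h g (inj₁ (a , i)) = p * (g (inj₁ a) ∸ 1) + nm i
induced {A = A} p k h g (inj₂ ((a , i) , (b , j) , e)) =
  p * (g (inj₂ (a , b , proj₁ (Equivalence.to T-∧ e))) ∸ 1)
  + ((k + p) ∸ (nm i + nm j))

DigraphIso : {V W : Set} → Rel V → Rel W → Set
DigraphIso {V} {W} A B =
  Σ (V ↔ W) λ φ → ∀ x y → A x y ≡ B (Inverse.to φ x) (Inverse.to φ y)

LabeledIso : {V W : Set} (A : Rel V) → Labeling A → (B : Rel W) → Labeling B → Set
LabeledIso {V} {W} A f B g =
  Σ (V ↔ W) λ φ →
  Σ (∀ x y → A x y ≡ B (Inverse.to φ x) (Inverse.to φ y)) λ pres →
    (∀ x → f (inj₁ x) ≡ g (inj₁ (Inverse.to φ x)))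
    × (∀ x y (e : T (A x y)) →
         f (inj₂ (x , y , e))
         ≡ g (inj₂ (Inverse.to φ x , Inverse.to φ y , subst T (pres x y) e)))

-- Renaming every vertex i of each factor F ∈ S_p^k to p + 1 - i sends an arc
-- sum s to 2(p + 1) - s, so the interval [k , k + p - 1] of arc sums becomes
-- [p + 3 - k , 2p + 2 - k]: the renamed factors lie in S_p^{p+3-k}, and
-- (a , i) ↦ (a , p + 1 - i) is an isomorphism of the two products.  A label
-- p(g - 1) + x with 1 ≤ x ≤ p is complemented (with respect to (n + m)p) to
-- p(ḡ - 1) + (p + 1 - x), where ḡ is the complement of g with respect to
-- n + m.  On a vertex (a , i) this is the induced label of (a , p + 1 - i);
-- on an arc the offsets x = k + p - s and x' = k' + p - s' of the two
-- products add up to p + 1, so it is the induced label of the renamed arc.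
module Submission where

open import Defs
open import Data.Nat using (ℕ; suc; _+_; _*_; _∸_; _≤_; s≤s; z≤n)
open import Data.Nat.Properties
open import Data.Nat.Tactic.RingSolver using (solve)
open import Algebra.Properties.CommutativeSemigroup +-commutativeSemigroup using (interchange)
open import Data.Fin using (Fin; toℕ; opposite)
open import Data.Fin.Properties using (opposite-prop; opposite-involutive; toℕ<n)
open import Data.Bool using (T; _∧_)
open import Data.Bool.Properties using (T-∧; T-irrelevant)
open import Data.List using ([]; _∷_)
open import Data.Product using (Σ; ∃; _×_; _,_; proj₁; proj₂)
open import Data.Sum using (inj₁; inj₂)
open import Function.Bundles using (_↔_; Inverse; Equivalence; mk↔ₛ′)
open import Function.Properties.Inverse using (↔-trans)
open import Relation.Binary.PropositionalEquality
open ≤-Reasoning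

+≡⇒∸≡ : ∀ m {n o} → m + n ≡ o → o ∸ m ≡ n
+≡⇒∸≡ m {n} refl = m+n∸m≡n m n

∸+∸≡ : ∀ {s s' d d' c} → s ≤ d → s' ≤ d' → s + s' + c ≡ d + d' →
       (d ∸ s) + (d' ∸ s') ≡ c
∸+∸≡ {s} {s'} {d} {d'} {c} s≤d s'≤d' eq = sym (+-cancelˡ-≡ (s + s') c _ (begin-equality
  s + s' + c                        ≡⟨ eq ⟩
  d + d'                            ≡⟨ cong₂ _+_ (m+[n∸m]≡n s≤d) (m+[n∸m]≡n s'≤d') ⟨
  s + (d ∸ s) + (s' + (d' ∸ s'))    ≡⟨ interchange s (d ∸ s) s' (d' ∸ s') ⟩
  s + s' + ((d ∸ s) + (d' ∸ s'))    ∎))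

reflect-interval : ∀ {k k' q s s'} → s + s' ≡ k + k' + q →
                   k ≤ s' → s' ≤ k + q → k' ≤ s × s ≤ k' + q
reflect-interval {k} {k'} {q} {s} {s'} eq k≤s' s'≤k+q =
  +-cancelʳ-≤ (k + q) k' s (begin
    k' + (k + q)  ≡⟨ solve (k ∷ k' ∷ q ∷ []) ⟩
    k + k' + q    ≡⟨ eq ⟨
    s + s'        ≤⟨ +-monoʳ-≤ s s'≤k+q ⟩
    s + (k + q)   ∎)
  , +-cancelʳ-≤ k s (k' + q) (begin
    s + k         ≤⟨ +-monoʳ-≤ s k≤s' ⟩
    s + s'        ≡⟨ eq ⟩
    k + k' + q    ≡⟨ solve (k ∷ k' ∷ q ∷ []) ⟩
    k' + q + k    ∎)

complement-block : ∀ {N p F x x'} → 1 ≤ F → F ≤ N → x + x' ≡ suc p →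
  suc (N * p) ∸ (p * (F ∸ 1) + x) ≡ p * ((suc N ∸ F) ∸ 1) + x'
complement-block {p = p} {F = suc F} {x} {x'} (s≤s z≤n) F≤N x+x'
  with G , refl ← m≤n⇒∃[o]m+o≡n F≤N = begin-equality
    suc ((suc F + G) * p) ∸ (p * F + x)  ≡⟨ +≡⇒∸≡ (p * F + x) blocks ⟩
    p * G + x'                           ≡⟨ cong (λ c → p * (c ∸ 1) + x') complementIndex ⟨
    p * ((suc (suc F + G) ∸ suc F) ∸ 1) + x' ∎
  where
  complementIndex : suc F + G ∸ F ≡ suc G
  complementIndex = +≡⇒∸≡ F (+-suc F G)
  blocks : p * F + x + (p * G + x') ≡ suc ((suc F + G) * p)
  blocks = begin-equality
    p * F + x + (p * G + x')  ≡⟨ solve (p ∷ F ∷ G ∷ x ∷ x' ∷ []) ⟩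
    p * F + p * G + (x + x')  ≡⟨ cong (p * F + p * G +_) x+x' ⟩
    p * F + p * G + suc p     ≡⟨ solve (p ∷ F ∷ G ∷ []) ⟩
    suc ((suc F + G) * p)     ∎

nm-opposite : ∀ {p} (i : Fin p) → nm i + nm (opposite i) ≡ suc p
nm-opposite {p} i = begin-equality
  suc (toℕ i) + suc (toℕ (opposite i))  ≡⟨ cong (λ c → suc (toℕ i) + suc c) (opposite-prop i) ⟩
  suc (toℕ i) + suc (p ∸ suc (toℕ i))  ≡⟨ +-suc (suc (toℕ i)) _ ⟩
  suc (suc (toℕ i) + (p ∸ suc (toℕ i))) ≡⟨ cong suc (m+[n∸m]≡n (toℕ<n i)) ⟩
  suc p                                 ∎

nm-opposite₂ : ∀ {p} (i j : Fin p) →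
  (nm i + nm j) + (nm (opposite i) + nm (opposite j)) ≡ suc p + suc p
nm-opposite₂ i j = begin-equality
  (nm i + nm j) + (nm (opposite i) + nm (opposite j))
    ≡⟨ interchange (nm i) (nm j) (nm (opposite i)) (nm (opposite j)) ⟩
  (nm i + nm (opposite i)) + (nm j + nm (opposite j))
    ≡⟨ cong₂ _+_ (nm-opposite i) (nm-opposite j) ⟩
  _ ∎

oppositeRel : ∀ {p} → Rel (Fin p) → Rel (Fin p)
oppositeRel F i j = F (opposite i) (opposite j)

oppositeRel-involutive : ∀ {p} (F : Rel (Fin p)) i j → oppositeRel (oppositeRel F) i j ≡ F i j
oppositeRel-involutive F i j = cong₂ F (opposite-involutive i) (opposite-involutive j)

arc-≡ : ∀ {V} {F : Rel V} {i i' j j'} {t : T (F i j)} {t' : T (F i' j')} →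
        i ≡ i' → j ≡ j' → _≡_ {A = Arcs F} (i , j , t) (i' , j' , t')
arc-≡ {t = t} {t'} refl refl = cong (λ u → _ , _ , u) (T-irrelevant t t')

oppositeArc : ∀ {p} {F : Rel (Fin p)} → Arcs F → Arcs (oppositeRel F)
oppositeArc {F = F} (i , j , t) =
  opposite i , opposite j , subst T (sym (oppositeRel-involutive F i j)) t

Arcs-oppositeRel : ∀ {p} (F : Rel (Fin p)) → Arcs (oppositeRel F) ↔ Arcs F
Arcs-oppositeRel F = mk↔ₛ′ (λ { (i , j , t) → opposite i , opposite j , t }) oppositeArc
  (λ { (i , j , _) → arc-≡ (opposite-involutive i) (opposite-involutive j) })
  (λ { (i , j , _) → arc-≡ (opposite-involutive i) (opposite-involutive j) })

+-suc-∸1 : ∀ k q → k + suc q ∸ 1 ≡ k + q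
+-suc-∸1 k q = cong (_∸ 1) (+-suc k q)

InS-minSum≤ : ∀ {q k F} → InS (suc q) k F → k ≤ suc (suc q)
InS-minSum≤ {q} {k} (_ , _ , onto)
  with (i , j , _) , sum≡ ← onto (k + suc q ∸ 1)
         (≤-trans (m≤m+n k q) (≤-reflexive (sym (+-suc-∸1 k q)))) ≤-refl =
  +-cancelʳ-≤ q k (suc (suc q)) (begin
    k + q                   ≡⟨ +-suc-∸1 k q ⟨
    k + suc q ∸ 1           ≡⟨ sum≡ ⟨
    nm i + nm j             ≤⟨ +-mono-≤ (toℕ<n i) (toℕ<n j) ⟩
    suc q + suc q           ≡⟨ +-suc (suc q) q ⟩
    suc (suc q) + q         ∎)

module OppositeFactor {q k : ℕ} {F : Rel (Fin (suc q))} (F∈S : InS (suc q) k F) where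

  private
    bounds : ∀ i j → T (F i j) → k ≤ nm i + nm j × nm i + nm j ≤ k + suc q ∸ 1
    bounds = proj₁ (proj₂ F∈S)
    onto : ∀ s → k ≤ s → s ≤ k + suc q ∸ 1 →
           ∃ λ (e : Arcs F) → nm (proj₁ e) + nm (proj₁ (proj₂ e)) ≡ s
    onto = proj₂ (proj₂ F∈S)

  k' : ℕ
  k' = suc q + 3 ∸ k

  k+k' : k + k' ≡ suc q + 3
  k+k' = m+[n∸m]≡n (begin
    k               ≤⟨ InS-minSum≤ F∈S ⟩
    suc (suc q)     ≤⟨ m≤m+n (suc (suc q)) 2 ⟩
    suc (suc q) + 2 ≡⟨ solve (q ∷ []) ⟩
    suc q + 3       ∎)

  -- The intervals [k , k + q] and [k' , k' + q] are mirror images about q + 2 = p + 1.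
  sumOfSums : k + k' + q ≡ suc (suc q) + suc (suc q)
  sumOfSums = begin-equality
    k + k' + q                ≡⟨ cong (_+ q) k+k' ⟩
    suc q + 3 + q             ≡⟨ solve (q ∷ []) ⟩
    suc (suc q) + suc (suc q) ∎

  sumOfSums′ : k' + k + q ≡ suc (suc q) + suc (suc q)
  sumOfSums′ = trans (cong (_+ q) (+-comm k' k)) sumOfSums

  reflect-arcSum : ∀ i j → T (F i j) →
    k' ≤ nm (opposite i) + nm (opposite j) × nm (opposite i) + nm (opposite j) ≤ k' + q
  reflect-arcSum i j t = reflect-interval
    (begin-equality
      nm (opposite i) + nm (opposite j) + (nm i + nm j)
        ≡⟨ +-comm (nm (opposite i) + nm (opposite j)) (nm i + nm j) ⟩
      nm i + nm j + (nm (opposite i) + nm (opposite j))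
        ≡⟨ nm-opposite₂ i j ⟩
      suc (suc q) + suc (suc q)
        ≡⟨ sumOfSums ⟨
      k + k' + q ∎)
    (proj₁ (bounds i j t))
    (≤-trans (proj₂ (bounds i j t)) (≤-reflexive (+-suc-∸1 k q)))

  InS-oppositeRel : InS (suc q) k' (oppositeRel F)
  InS-oppositeRel = ↔-trans (Arcs-oppositeRel F) (proj₁ F∈S) , bounds′ , onto′
    where
    bounds′ : ∀ i j → T (oppositeRel F i j) →
              k' ≤ nm i + nm j × nm i + nm j ≤ k' + suc q ∸ 1
    bounds′ i j t
      with lo , hi ← reflect-arcSum (opposite i) (opposite j) t
      rewrite opposite-involutive i | opposite-involutive j =
      lo , ≤-trans hi (≤-reflexive (sym (+-suc-∸1 k' q)))
    -- The arc of F with the reflected sum 2(q + 2) - s, renamed, has sum s.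
    onto′ : ∀ s → k' ≤ s → s ≤ k' + suc q ∸ 1 →
            ∃ λ (e : Arcs (oppositeRel F)) → nm (proj₁ e) + nm (proj₁ (proj₂ e)) ≡ s
    onto′ s k'≤s s≤ =
      renamed (onto s' (proj₁ s'∈) (≤-trans (proj₂ s'∈) (≤-reflexive (sym (+-suc-∸1 k q)))))
      where
      s≤k'+q : s ≤ k' + q
      s≤k'+q = ≤-trans s≤ (≤-reflexive (+-suc-∸1 k' q))
      s' : ℕ
      s' = suc (suc q) + suc (suc q) ∸ s
      s+s' : s + s' ≡ suc (suc q) + suc (suc q)
      s+s' = m+[n∸m]≡n (begin
        s          ≤⟨ s≤k'+q ⟩
        k' + q     ≤⟨ +-monoˡ-≤ q (m≤n+m k' k) ⟩
        k + k' + q ≡⟨ sumOfSums ⟩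
        _          ∎)
      s'∈ : k ≤ s' × s' ≤ k + q
      s'∈ = reflect-interval (trans (+-comm s' s) (trans s+s' (sym sumOfSums′))) k'≤s s≤k'+q
      renamed : (∃ λ (e : Arcs F) → nm (proj₁ e) + nm (proj₁ (proj₂ e)) ≡ s') →
                ∃ λ (e : Arcs (oppositeRel F)) → nm (proj₁ e) + nm (proj₁ (proj₂ e)) ≡ s
      renamed ((i , j , t) , sum≡) = oppositeArc (i , j , t) , +-cancelˡ-≡ s' _ s (begin-equality
        s' + (nm (opposite i) + nm (opposite j))
          ≡⟨ cong (_+ (nm (opposite i) + nm (opposite j))) sum≡ ⟨
        (nm i + nm j) + (nm (opposite i) + nm (opposite j))
          ≡⟨ nm-opposite₂ i j ⟩
        suc (suc q) + suc (suc q)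
          ≡⟨ s+s' ⟨
        s + s'
          ≡⟨ +-comm s s' ⟩
        s' + s ∎)

  offsets-sum : ∀ i j → T (F i j) →
    (k + suc q ∸ (nm i + nm j)) + (k' + suc q ∸ (nm (opposite i) + nm (opposite j))) ≡ suc (suc q)
  offsets-sum i j t = ∸+∸≡
    (≤-trans (proj₂ (bounds i j t)) (≤-trans (≤-reflexive (+-suc-∸1 k q)) (+-monoʳ-≤ k (n≤1+n q))))
    (≤-trans (proj₂ (reflect-arcSum i j t)) (+-monoʳ-≤ k' (n≤1+n q)))
    (begin-equality
      (nm i + nm j) + (nm (opposite i) + nm (opposite j)) + suc (suc q)
        ≡⟨ cong (_+ suc (suc q)) (nm-opposite₂ i j) ⟩
      suc (suc q) + suc (suc q) + suc (suc q)
        ≡⟨ solve (q ∷ []) ⟩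
      suc q + 3 + (suc q + suc q)
        ≡⟨ cong (_+ (suc q + suc q)) k+k' ⟨
      k + k' + (suc q + suc q)
        ≡⟨ interchange k k' (suc q) (suc q) ⟩
      k + suc q + (k' + suc q) ∎)

oppositeFibre : ∀ {V : Set} {p} → (V × Fin p) ↔ (V × Fin p)
oppositeFibre = mk↔ₛ′ flipFibre flipFibre
  (λ { (a , i) → cong (a ,_) (opposite-involutive i) })
  (λ { (a , i) → cong (a ,_) (opposite-involutive i) })
  where
  flipFibre : ∀ {V : Set} {p} → V × Fin p → V × Fin p
  flipFibre (a , i) = a , opposite i

oppositeFactors : ∀ {V : Set} {p} → (V → V → Rel (Fin p)) → V → V → Rel (Fin p)
oppositeFactors h a b = oppositeRel (h a b)

prodArc-oppositeFactors : ∀ {V : Set} {p} (A : Rel V) (h : V → V → Rel (Fin p)) x y →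
  prodArc A h x y
  ≡ prodArc A (oppositeFactors h) (Inverse.to oppositeFibre x) (Inverse.to oppositeFibre y)
prodArc-oppositeFactors A h (a , i) (b , j) =
  cong (A a b ∧_) (sym (oppositeRel-involutive (h a b) i j))

module InducedComplement {n m q k : ℕ} {A : Rel (Fin n)} {f : Labeling A}
         (f∈ : ∀ l → 1 ≤ f l × f l ≤ n + m)
         {h : Fin n → Fin n → Rel (Fin (suc q))}
         (h∈S : ∀ a b → T (A a b) → InS (suc q) k (h a b)) where

  private
    p k' : ℕ
    p = suc q
    k' = p + 3 ∸ k

  complement-blockLabel : ∀ {x x'} l → x + x' ≡ suc p →
    suc (n * p + m * p) ∸ (p * (f l ∸ 1) + x) ≡ p * (complement n m f l ∸ 1) + x'
  complement-blockLabel {x} l x+x' =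
    trans (cong (λ c → suc c ∸ (p * (f l ∸ 1) + x)) (sym (*-distribʳ-+ p n m)))
          (complement-block (proj₁ (f∈ l)) (proj₂ (f∈ l)) x+x')

  complement-induced-vertex : ∀ x →
    complement (n * p) (m * p) (induced p k h f) (inj₁ x)
    ≡ induced p k' (oppositeFactors h) (complement n m f) (inj₁ (Inverse.to oppositeFibre x))
  complement-induced-vertex (a , i) = complement-blockLabel (inj₁ a) (nm-opposite i)

  complement-induced-arc : ∀ x y (e : T (prodArc A h x y)) →
    complement (n * p) (m * p) (induced p k h f) (inj₂ (x , y , e))
    ≡ induced p k' (oppositeFactors h) (complement n m f)
        (inj₂ (Inverse.to oppositeFibre x , Inverse.to oppositeFibre y ,
               subst T (prodArc-oppositeFactors A h x y) e))
  complement-induced-arc (a , i) (b , j) e =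
    trans (complement-blockLabel (inj₂ (a , b , t)) (OppositeFactor.offsets-sum (h∈S a b t) i j u))
          (cong (λ t′ → p * (complement n m f (inj₂ (a , b , t′)) ∸ 1) + _) (T-irrelevant _ _))
    where
    t : T (A a b)
    t = proj₁ (Equivalence.to T-∧ e)
    u : T (h a b i j)
    u = proj₂ (Equivalence.to T-∧ e)

proposition2p2 : (n m : ℕ) (A : Rel (Fin n)) → (Arcs A ↔ Fin m) →
    (f : Labeling A) → IsEdgeMagic A n m f →
    (p k : ℕ) → 1 ≤ p → 1 ≤ k →
    (h : Fin n → Fin n → Rel (Fin p)) →
    (∀ a b → T (A a b) → InS p k (h a b)) →
    Σ (Fin n → Fin n → Rel (Fin p)) λ hb →
      (∀ a b → T (A a b) → InS p (p + 3 ∸ k) (hb a b))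
      × DigraphIso (prodArc A h) (prodArc A hb)
      × LabeledIso (prodArc A h)
          (complement (n * p) (m * p) (induced p k h f))
          (prodArc A hb)
          (induced p (p + 3 ∸ k) hb (complement n m f))
proposition2p2 n m A _ f ((f∈ , _) , _) (suc q) k (s≤s z≤n) _ h h∈S =
    oppositeFactors h
  , (λ a b t → OppositeFactor.InS-oppositeRel (h∈S a b t))
  , (oppositeFibre , prodArc-oppositeFactors A h)
  , (oppositeFibre , prodArc-oppositeFactors A h
    , complement-induced-vertex , complement-induced-arc)
  where open InducedComplement f∈ h∈S
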